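{- Let $a\in\mathbb{C}$, $\mathbf{k}=(k_1,\ldots,k_r)\in\mathbb{N}^r$, $\mathbf{x}=(x_1,\ldots,x_r)$ with $|x_j|\le1$, $n\in\mathbb{N}$ and $l\in\mathbb{N}_0$. Then \[ \sum_{n\ge n_1>\cdots>n_r>0}\prod_{j=1}^r\frac{x_j^{n_j+l+a}}{(n_j+l+a)^{k_j}}=(-1)^r\sum_{j=0}^r(-1)^j\zeta_{n+l}(k_1,\ldots,k_j;x_1,\ldots,x_j;a)\,\zeta^\star_l(k_r,\ldots,k_{j+1};x_r,\ldots,x_{j+1};a). \]
   Context: $\zeta_N(k_1,\ldots,k_s;y_1,\ldots,y_s;a)=\sum_{N\ge n_1>\cdots>n_s\ge1}\prod_i\frac{y_i^{n_i+a}}{(n_i+a)^{k_i}}$ and $\zeta^\star_N(k_1,\ldots,k_s;y_1,\ldots,y_s;a)=\sum_{N\ge n_1\ge\cdots\ge n_s\ge1}\prod_i\frac{y_i^{n_i+a}}{(n_i+a)^{k_i}}$, equal to $1$ for the empty index, empty sums being $0$. Here $a$ is not a negative integer, and $y^{m+a}$ means $y^m y^a$ for a fixed determination of each $y_i^a$. -}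

module Defs where

open import Level using (Level; _⊔_) renaming (suc to lsuc)
open import Algebra.Bundles using (CommutativeRing)
open import Data.Nat using (ℕ; zero; suc; _∸_)
open import Data.Fin using (Fin)
open import Data.List using (List; []; _∷_; take; drop; reverse; tabulate)
open import Data.Product using (_×_; _,_)
open import Relation.Nullary using (¬_)

-- A field: a commutative ring with 1 ≠ 0 and a (total) inverse function
-- that is a multiplicative inverse on nonzero elements.  ℂ is an instance.
record Field (c ℓ : Level) : Set (lsuc (c ⊔ ℓ)) where
  field
    commutativeRing : CommutativeRing c ℓ
  open CommutativeRing commutativeRing public
  field
    _⁻¹        : Carrier → Carrier
    1≉0        : ¬ (1# ≈ 0#)
    inverseʳ   : ∀ x → ¬ (x ≈ 0#) → (x * (x ⁻¹)) ≈ 1#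

module FieldOps {c ℓ : Level} (F : Field c ℓ) where
  open Field F public using (Carrier; _≈_; _+_; _*_; -_; 0#; 1#; _⁻¹)

  pow : Carrier → ℕ → Carrier
  pow x zero    = 1#
  pow x (suc m) = x * pow x m

  fromℕ : ℕ → Carrier
  fromℕ zero    = 0#
  fromℕ (suc m) = 1# + fromℕ m

  sum1 : ℕ → (ℕ → Carrier) → Carrier
  sum1 zero    g = 0#
  sum1 (suc N) g = sum1 N g + g (suc N)

  sum0 : ℕ → (ℕ → Carrier) → Carrier
  sum0 zero    g = g zero
  sum0 (suc N) g = sum0 N g + g (suc N)

  -- Generic nested sums for a list of summand functions f_1,…,f_s:
  -- S  N (f_1…f_s) = Σ_{N ≥ n_1 > ⋯ > n_s ≥ 1} ∏ f_i(n_i)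
  -- S⋆ N (f_1…f_s) = Σ_{N ≥ n_1 ≥ ⋯ ≥ n_s ≥ 1} ∏ f_i(n_i)
  -- (both equal to 1 for the empty list)
  S : ℕ → List (ℕ → Carrier) → Carrier
  S N []       = 1#
  S N (f ∷ fs) = sum1 N (λ m → f m * S (m ∸ 1) fs)

  S⋆ : ℕ → List (ℕ → Carrier) → Carrier
  S⋆ N []       = 1#
  S⋆ N (f ∷ fs) = sum1 N (λ m → f m * S⋆ m fs)

  -- An index entry (k , y , yᵃ): exponent k, variable y, and a fixed
  -- determination yᵃ of y^a.  Its summand at m is y^{m+a}/(m+a)^k
  -- with y^{m+a} := y^m · yᵃ.
  Idx : Set c
  Idx = ℕ × Carrier × Carrier

  term : Carrier → Idx → ℕ → Carrier
  term a (k , y , ya) m = (pow y m * ya) * (pow (fromℕ m + a) k) ⁻¹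

  ζ : ℕ → List Idx → Carrier → Carrier
  ζ N ids a = S N (Data.List.map (term a) ids)

  ζ⋆ : ℕ → List Idx → Carrier → Carrier
  ζ⋆ N ids a = S⋆ N (Data.List.map (term a) ids)

  idxList : (r : ℕ) → (Fin r → ℕ) → (Fin r → Carrier) → (Fin r → Carrier) → List Idx
  idxList r k x xa = tabulate (λ j → (k j , x j , xa j))

-- Nothing about the summands is used: the identity holds for arbitrary functions f_1, …, f_r
-- in any commutative ring.  Let A_l(f_1,…,f_r)
-- be the alternating sum on the right-hand side.  Splitting off the last function f, both the
-- smallest index of S_N and the largest index of S⋆_l run over m, which gives
--   A_l(f_1,…,f_r) = Σ_{m ≤ l} f(m) A_m(f_1,…,f_{r-1}) + (-1)^r S_N(f_1,…,f_r).
-- By induction on r the first sum is -(-1)^r times the part of S_N(f_1,…,f_r) whose smallest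
-- index is ≤ l, so A_l is (-1)^r times the sum over N ≥ n_1 > ⋯ > n_r > l, which is the
-- left-hand side after shifting every index by l.
module Submission where

open import Defs
open import Level using (Level)
open import Data.Nat using (ℕ; suc; _≤_)
open import Data.Fin using (Fin)
open import Data.List using (List; map; take; drop; reverse)
open import Relation.Nullary using (¬_)

import Data.Nat as ℕ
open import Data.Nat using (zero; _<_; _∸_; s≤s)
import Data.Nat.Properties as ℕ
open import Data.Nat.Properties
  using (≤-trans; ≤-reflexive; m<n⇒m<1+n; n<1+n; m≤n+m; m+n∸n≡m; m∸n+n≡m; n∸n≡0; +-∸-assoc; ∸-+-assoc)
open import Data.List using ([]; _∷_; _∷ʳ_; [_]; length)
open import Data.List.Properties
  using (map-++; map-∘; length-map; take-map; drop-map; reverse-map; reverse-++; take-all; drop-all; length-tabulate)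
open import Data.List.Reverse using (Reverse; []; _∶_∶ʳ_; reverseView)
open import Data.Product using (_,_)
open import Function using (_∘_)
open import Relation.Binary.PropositionalEquality as ≡ using (_≡_; cong; cong₂)

module _ {a} {A : Set a} where

  length-∷ʳ : ∀ (xs : List A) x → length (xs ∷ʳ x) ≡ suc (length xs)
  length-∷ʳ []       x = ≡.refl
  length-∷ʳ (y ∷ xs) x = cong suc (length-∷ʳ xs x)

  take-∷ʳ : ∀ j (xs : List A) x → j ≤ length xs → take j (xs ∷ʳ x) ≡ take j xs
  take-∷ʳ zero    xs       x _       = ≡.refl
  take-∷ʳ (suc j) (y ∷ xs) x (s≤s p) = cong (y ∷_) (take-∷ʳ j xs x p)

  drop-∷ʳ : ∀ j (xs : List A) x → j ≤ length xs → drop j (xs ∷ʳ x) ≡ drop j xs ∷ʳ x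
  drop-∷ʳ zero    xs       x _       = ≡.refl
  drop-∷ʳ (suc j) (y ∷ xs) x (s≤s p) = drop-∷ʳ j xs x p

  reverse-∷ʳ : ∀ (xs : List A) x → reverse (xs ∷ʳ x) ≡ x ∷ reverse xs
  reverse-∷ʳ xs x = reverse-++ xs [ x ]

module NestedSums {c ℓ : Level} (F : Field c ℓ) where

  open FieldOps F
  open Field F using (setoid; refl; sym; trans; reflexive; +-cong; *-cong; *-congˡ; *-congʳ;
    +-assoc; *-assoc; +-identityˡ; +-identityʳ; *-identityˡ; *-identityʳ; zeroʳ; distribˡ; -‿inverseʳ;
    ring; +-commutativeSemigroup; *-commutativeSemigroup)
  open import Algebra.Properties.Ring ring using (-1*x≈-x; -‿involutive)
  open import Algebra.Properties.CommutativeSemigroup +-commutativeSemigroup using (interchange)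
  open import Algebra.Properties.CommutativeSemigroup *-commutativeSemigroup
    using (x∙yz≈y∙xz) renaming (interchange to *-interchange)
  open import Relation.Binary.Reasoning.Setoid setoid

  shift : ℕ → (ℕ → Carrier) → ℕ → Carrier
  shift l f m = f (m ℕ.+ l)

  sum1-cong : ∀ N {g h : ℕ → Carrier} → (∀ m → m < N → g (suc m) ≈ h (suc m)) → sum1 N g ≈ sum1 N h
  sum1-cong zero    eq = refl
  sum1-cong (suc N) eq = +-cong (sum1-cong N (λ m m<N → eq m (m<n⇒m<1+n m<N))) (eq N (n<1+n N))

  sum1-+ : ∀ N (g h : ℕ → Carrier) → sum1 N (λ m → g m + h m) ≈ sum1 N g + sum1 N h
  sum1-+ zero    g h = sym (+-identityʳ 0#)
  sum1-+ (suc N) g h = trans (+-cong (sum1-+ N g h) refl) (interchange _ _ _ _)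

  sum1-distribˡ : ∀ N x (g : ℕ → Carrier) → x * sum1 N g ≈ sum1 N (λ m → x * g m)
  sum1-distribˡ zero    x g = zeroʳ x
  sum1-distribˡ (suc N) x g = trans (distribˡ x _ _) (+-cong (sum1-distribˡ N x g) refl)

  sum1-split : ∀ d l (g : ℕ → Carrier) → sum1 (d ℕ.+ l) g ≈ sum1 l g + sum1 d (λ e → g (e ℕ.+ l))
  sum1-split zero    l g = sym (+-identityʳ _)
  sum1-split (suc d) l g = trans (+-cong (sum1-split d l g) refl) (+-assoc _ _ _)

  sum1-split-≤ : ∀ {l N} (g : ℕ → Carrier) → l ≤ N →
    sum1 N g ≈ sum1 l g + sum1 (N ∸ l) (λ e → g (e ℕ.+ l))
  sum1-split-≤ {l} {N} g l≤N =
    ≡.subst (λ M → sum1 M g ≈ sum1 l g + sum1 (N ∸ l) (λ e → g (e ℕ.+ l))) (m∸n+n≡m l≤N)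
      (sum1-split (N ∸ l) l g)

  sum1-triangle : ∀ N (K : ℕ → ℕ → Carrier) →
    sum1 N (λ n → sum1 (n ∸ 1) (λ m → K m n)) ≈ sum1 N (λ m → sum1 (N ∸ m) (λ d → K m (d ℕ.+ m)))
  sum1-triangle zero    K = refl
  sum1-triangle (suc N) K = begin
    sum1 N (λ n → sum1 (n ∸ 1) (λ m → K m n)) + sum1 N (λ m → K m (suc N))
      ≈⟨ +-cong (sum1-triangle N K) refl ⟩
    sum1 N (λ m → row N m) + sum1 N (λ m → K m (suc N))
      ≈⟨ sym (sum1-+ N _ _) ⟩
    sum1 N (λ m → row N m + K m (suc N))
      ≈⟨ sum1-cong N extend ⟩
    sum1 N (λ m → row (suc N) m)
      ≈⟨ sym (+-identityʳ _) ⟩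
    sum1 N (λ m → row (suc N) m) + 0#
      ≡⟨ cong (λ M → sum1 N (λ m → row (suc N) m) + sum1 M (λ d → K (suc N) (d ℕ.+ suc N)))
             (≡.sym (n∸n≡0 N)) ⟩
    sum1 (suc N) (λ m → row (suc N) m) ∎
    where
    row : ℕ → ℕ → Carrier
    row M m = sum1 (M ∸ m) (λ d → K m (d ℕ.+ m))
    extend : ∀ m → m < N → row N (suc m) + K (suc m) (suc N) ≈ row (suc N) (suc m)
    extend m m<N = begin
      row N (suc m) + K (suc m) (suc N)
        ≡⟨ cong (λ n → row N (suc m) + K (suc m) (suc n)) (≡.sym (m∸n+n≡m m<N)) ⟩
      sum1 (suc (N ∸ suc m)) (λ d → K (suc m) (d ℕ.+ suc m))
        ≡⟨ cong (λ M → sum1 M (λ d → K (suc m) (d ℕ.+ suc m))) (≡.sym (+-∸-assoc 1 m<N)) ⟩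
      row (suc N) (suc m) ∎

  sum0-cong : ∀ r {g h : ℕ → Carrier} → (∀ j → j ≤ r → g j ≈ h j) → sum0 r g ≈ sum0 r h
  sum0-cong zero    eq = eq zero ℕ.z≤n
  sum0-cong (suc r) eq = +-cong (sum0-cong r (λ j j≤r → eq j (ℕ.m≤n⇒m≤1+n j≤r))) (eq (suc r) ℕ.≤-refl)

  sum0-distribˡ : ∀ r x (g : ℕ → Carrier) → x * sum0 r g ≈ sum0 r (λ j → x * g j)
  sum0-distribˡ zero    x g = refl
  sum0-distribˡ (suc r) x g = trans (distribˡ x _ _) (+-cong (sum0-distribˡ r x g) refl)

  sum0-sum1-comm : ∀ r N (A : ℕ → ℕ → Carrier) →
    sum0 r (λ j → sum1 N (A j)) ≈ sum1 N (λ m → sum0 r (λ j → A j m))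
  sum0-sum1-comm zero    N A = refl
  sum0-sum1-comm (suc r) N A = trans (+-cong (sum0-sum1-comm r N A) refl) (sym (sum1-+ N _ _))

  -- The last index n_s = m splits off; the others then range over (m, N], i.e. shifted by m.
  S-∷ʳ : ∀ N gs f → S N (gs ∷ʳ f) ≈ sum1 N (λ m → f m * S (N ∸ m) (map (shift m) gs))
  S-∷ʳ N []       f = refl
  S-∷ʳ N (g ∷ gs) f = begin
    sum1 N (λ n → g n * S (n ∸ 1) (gs ∷ʳ f))
      ≈⟨ sum1-cong N (λ n _ → *-congˡ (S-∷ʳ n gs f)) ⟩
    sum1 N (λ n → g n * sum1 (n ∸ 1) (λ m → f m * S (n ∸ 1 ∸ m) (map (shift m) gs)))
      ≈⟨ sum1-cong N (λ n _ → sum1-distribˡ n (g (suc n)) _) ⟩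
    sum1 N (λ n → sum1 (n ∸ 1) (λ m → K m n))
      ≈⟨ sum1-triangle N K ⟩
    sum1 N (λ m → sum1 (N ∸ m) (λ d → K m (d ℕ.+ m)))
      ≈⟨ sum1-cong N (λ m _ → pull (suc m)) ⟩
    sum1 N (λ m → f m * S (N ∸ m) (map (shift m) (g ∷ gs))) ∎
    where
    K : ℕ → ℕ → Carrier
    K m n = g n * (f m * S (n ∸ 1 ∸ m) (map (shift m) gs))
    pull : ∀ m → sum1 (N ∸ m) (λ d → K m (d ℕ.+ m)) ≈ f m * S (N ∸ m) (map (shift m) (g ∷ gs))
    pull m = trans
      (sum1-cong (N ∸ m) (λ e _ → trans (x∙yz≈y∙xz _ _ _)
        (*-congˡ (*-congˡ (reflexive (cong (λ i → S i (map (shift m) gs)) (m+n∸n≡m e m)))))))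
      (sym (sum1-distribˡ (N ∸ m) (f m) _))

  S-shift-+ : ∀ M d l gs → S M (map (shift d) (map (shift l) gs)) ≈ S M (map (shift (d ℕ.+ l)) gs)
  S-shift-+ M d l []       = refl
  S-shift-+ M d l (g ∷ gs) =
    sum1-cong M (λ e _ → *-cong (reflexive (cong g (ℕ.+-assoc (suc e) d l))) (S-shift-+ e d l gs))

  S-shift-∷ʳ : ∀ N l gs f →
    S (N ∸ l) (map (shift l) (gs ∷ʳ f))
      ≈ sum1 (N ∸ l) (λ d → f (d ℕ.+ l) * S (N ∸ (d ℕ.+ l)) (map (shift (d ℕ.+ l)) gs))
  S-shift-∷ʳ N l gs f = begin
    S (N ∸ l) (map (shift l) (gs ∷ʳ f))
      ≡⟨ cong (S (N ∸ l)) (map-++ (shift l) gs [ f ]) ⟩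
    S (N ∸ l) (map (shift l) gs ∷ʳ shift l f)
      ≈⟨ S-∷ʳ (N ∸ l) (map (shift l) gs) (shift l f) ⟩
    sum1 (N ∸ l) (λ d → f (d ℕ.+ l) * S (N ∸ l ∸ d) (map (shift d) (map (shift l) gs)))
      ≈⟨ sum1-cong (N ∸ l) (λ d _ → *-congˡ (trans (S-shift-+ _ (suc d) l gs)
           (reflexive (cong (λ i → S i (map (shift (suc d ℕ.+ l)) gs)) (reindex (suc d)))))) ⟩
    sum1 (N ∸ l) (λ d → f (d ℕ.+ l) * S (N ∸ (d ℕ.+ l)) (map (shift (d ℕ.+ l)) gs)) ∎
    where
    reindex : ∀ d → N ∸ l ∸ d ≡ N ∸ (d ℕ.+ l)
    reindex d = ≡.trans (∸-+-assoc N l d) (cong (N ∸_) (ℕ.+-comm l d))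

  altSplit : ℕ → ℕ → List (ℕ → Carrier) → Carrier
  altSplit N l fs = sum0 (length fs) (λ j → pow (- 1#) j * (S N (take j fs) * S⋆ l (reverse (drop j fs))))

  altSplit-∷ʳ : ∀ N l gs f →
    altSplit N l (gs ∷ʳ f)
      ≈ sum1 l (λ m → f m * altSplit N m gs) + pow (- 1#) (suc (length gs)) * S N (gs ∷ʳ f)
  altSplit-∷ʳ N l gs f = begin
    altSplit N l (gs ∷ʳ f)
      ≡⟨ cong (λ R → sum0 R T) (length-∷ʳ gs f) ⟩
    sum0 r T + T (suc r)
      ≈⟨ +-cong (sum0-cong r first) last ⟩
    sum0 r (λ j → sum1 l (λ m → f m * U j m)) + pow (- 1#) (suc r) * S N (gs ∷ʳ f)
      ≈⟨ +-cong (trans (sum0-sum1-comm r l _)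
                       (sum1-cong l (λ m _ → sym (sum0-distribˡ r (f (suc m)) _)))) refl ⟩
    sum1 l (λ m → f m * altSplit N m gs) + pow (- 1#) (suc r) * S N (gs ∷ʳ f) ∎
    where
    r = length gs
    T : ℕ → Carrier
    T j = pow (- 1#) j * (S N (take j (gs ∷ʳ f)) * S⋆ l (reverse (drop j (gs ∷ʳ f))))
    U : ℕ → ℕ → Carrier
    U j m = pow (- 1#) j * (S N (take j gs) * S⋆ m (reverse (drop j gs)))
    first : ∀ j → j ≤ r → T j ≈ sum1 l (λ m → f m * U j m)
    first j j≤r = begin
      T j
        ≡⟨ cong₂ (λ xs ys → pow (- 1#) j * (S N xs * S⋆ l ys)) (take-∷ʳ j gs f j≤r)
             (≡.trans (cong reverse (drop-∷ʳ j gs f j≤r)) (reverse-∷ʳ (drop j gs) f)) ⟩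
      pow (- 1#) j * (S N (take j gs) * sum1 l (λ m → f m * S⋆ m (reverse (drop j gs))))
        ≈⟨ *-congˡ (sum1-distribˡ l _ _) ⟩
      pow (- 1#) j * sum1 l (λ m → S N (take j gs) * (f m * S⋆ m (reverse (drop j gs))))
        ≈⟨ sum1-distribˡ l _ _ ⟩
      sum1 l (λ m → pow (- 1#) j * (S N (take j gs) * (f m * S⋆ m (reverse (drop j gs)))))
        ≈⟨ sum1-cong l (λ m _ → trans (*-congˡ (x∙yz≈y∙xz _ _ _)) (x∙yz≈y∙xz _ _ _)) ⟩
      sum1 l (λ m → f m * U j m) ∎
    all : length (gs ∷ʳ f) ≤ suc r
    all = ≤-reflexive (length-∷ʳ gs f)
    last : T (suc r) ≈ pow (- 1#) (suc r) * S N (gs ∷ʳ f)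
    last = trans (reflexive (cong₂ (λ xs ys → pow (- 1#) (suc r) * (S N xs * S⋆ l (reverse ys)))
                    (take-all (suc r) (gs ∷ʳ f) all) (drop-all (suc r) (gs ∷ʳ f) all)))
                 (*-congˡ (*-identityʳ _))

  [-1]^r*[-1]^r≈1 : ∀ r → pow (- 1#) r * pow (- 1#) r ≈ 1#
  [-1]^r*[-1]^r≈1 zero    = *-identityˡ 1#
  [-1]^r*[-1]^r≈1 (suc r) = begin
    (- 1# * pow (- 1#) r) * (- 1# * pow (- 1#) r)
      ≈⟨ *-interchange _ _ _ _ ⟩
    (- 1# * - 1#) * (pow (- 1#) r * pow (- 1#) r)
      ≈⟨ *-cong (trans (-1*x≈-x (- 1#)) (-‿involutive 1#)) ([-1]^r*[-1]^r≈1 r) ⟩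
    1# * 1#
      ≈⟨ *-identityˡ 1# ⟩
    1# ∎

  x*y+[-1*x]*[y+z]≈[-1*x]*z : ∀ x y z → x * y + (- 1# * x) * (y + z) ≈ (- 1# * x) * z
  x*y+[-1*x]*[y+z]≈[-1*x]*z x y z = begin
    x * y + (- 1# * x) * (y + z)             ≈⟨ +-cong refl (distribˡ _ y z) ⟩
    x * y + ((- 1# * x) * y + (- 1# * x) * z) ≈⟨ sym (+-assoc _ _ _) ⟩
    (x * y + (- 1# * x) * y) + (- 1# * x) * z ≈⟨ +-cong x*y-x*y≈0 refl ⟩
    0# + (- 1# * x) * z                      ≈⟨ +-identityˡ _ ⟩
    (- 1# * x) * z ∎
    where
    x*y-x*y≈0 : x * y + (- 1# * x) * y ≈ 0#
    x*y-x*y≈0 = trans (+-cong refl (trans (*-assoc _ _ _) (-1*x≈-x (x * y)))) (-‿inverseʳ (x * y))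

  altSplit≈S-shift : ∀ fs {N l} → l ≤ N →
    altSplit N l fs ≈ pow (- 1#) (length fs) * S (N ∸ l) (map (shift l) fs)
  altSplit≈S-shift fs = go (reverseView fs)
    where
    go : ∀ {fs} → Reverse fs → ∀ {N l} → l ≤ N →
      altSplit N l fs ≈ pow (- 1#) (length fs) * S (N ∸ l) (map (shift l) fs)
    go []                 _   = *-congˡ (*-identityˡ 1#)
    go (gs ∶ rs ∶ʳ f) {N} {l} l≤N = begin
      altSplit N l (gs ∷ʳ f)
        ≈⟨ altSplit-∷ʳ N l gs f ⟩
      sum1 l (λ m → f m * altSplit N m gs) + σ′ * S N (gs ∷ʳ f)
        ≈⟨ +-cong (sum1-cong l (λ m m<l → *-congˡ (go rs (≤-trans m<l l≤N)))) (*-congˡ (S-∷ʳ N gs f)) ⟩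
      sum1 l (λ m → f m * (σ * A m)) + σ′ * sum1 N (λ m → f m * A m)
        ≈⟨ +-cong factor (*-congˡ (sum1-split-≤ (λ m → f m * A m) l≤N)) ⟩
      σ * B + σ′ * (B + C)
        ≈⟨ x*y+[-1*x]*[y+z]≈[-1*x]*z σ B C ⟩
      σ′ * C
        ≈⟨ *-congˡ (sym (S-shift-∷ʳ N l gs f)) ⟩
      σ′ * S (N ∸ l) (map (shift l) (gs ∷ʳ f))
        ≡⟨ cong (λ R → pow (- 1#) R * S (N ∸ l) (map (shift l) (gs ∷ʳ f))) (≡.sym (length-∷ʳ gs f)) ⟩
      pow (- 1#) (length (gs ∷ʳ f)) * S (N ∸ l) (map (shift l) (gs ∷ʳ f)) ∎
      where
      σ σ′ : Carrier
      σ  = pow (- 1#) (length gs)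
      σ′ = pow (- 1#) (suc (length gs))
      A : ℕ → Carrier
      A m = S (N ∸ m) (map (shift m) gs)
      B C : Carrier
      B = sum1 l (λ m → f m * A m)
      C = sum1 (N ∸ l) (λ d → f (d ℕ.+ l) * A (d ℕ.+ l))
      factor : sum1 l (λ m → f m * (σ * A m)) ≈ σ * B
      factor = trans (sum1-cong l (λ m _ → x∙yz≈y∙xz _ _ _)) (sym (sum1-distribˡ l σ _))

  altSplit-map : ∀ {b} {X : Set b} N l (t : X → ℕ → Carrier) xs →
    altSplit N l (map t xs)
      ≈ sum0 (length xs) (λ j → pow (- 1#) j * (S N (map t (take j xs)) * S⋆ l (map t (reverse (drop j xs)))))
  altSplit-map N l t xs = begin
    altSplit N l (map t xs)
      ≡⟨ cong (λ R → sum0 R (λ j → pow (- 1#) j * (S N (take j (map t xs)) * S⋆ l (reverse (drop j (map t xs))))))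
              (length-map t xs) ⟩
    sum0 (length xs) (λ j → pow (- 1#) j * (S N (take j (map t xs)) * S⋆ l (reverse (drop j (map t xs)))))
      ≈⟨ sum0-cong (length xs) (λ j _ → reflexive (≡.cong₂ (λ us vs → pow (- 1#) j * (S N us * S⋆ l vs))
            (take-map j xs) (≡.trans (cong reverse (drop-map j xs)) (≡.sym (reverse-map t (drop j xs)))))) ⟩
    sum0 (length xs) (λ j → pow (- 1#) j * (S N (map t (take j xs)) * S⋆ l (map t (reverse (drop j xs))))) ∎

  shifted-ζ : ∀ a n l ids →
    S n (map (λ e m → term a e (m ℕ.+ l)) ids)
      ≈ pow (- 1#) (length ids) * sum0 (length ids) (λ j → pow (- 1#) j
           * (ζ (n ℕ.+ l) (take j ids) a * ζ⋆ l (reverse (drop j ids)) a))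
  shifted-ζ a n l ids = begin
    S n (map (shift l ∘ term a) ids)
      ≡⟨ cong (S n) (map-∘ ids) ⟩
    S n (map (shift l) fs)
      ≡⟨ cong (λ M → S M (map (shift l) fs)) (≡.sym (m+n∸n≡m n l)) ⟩
    S (n ℕ.+ l ∸ l) (map (shift l) fs)
      ≈⟨ sym (σ*[σ*x]≈x _) ⟩
    σ * (σ * S (n ℕ.+ l ∸ l) (map (shift l) fs))
      ≈⟨ *-congˡ (sym (altSplit≈S-shift fs (m≤n+m l n))) ⟩
    σ * altSplit (n ℕ.+ l) l fs
      ≡⟨ cong (λ R → pow (- 1#) R * altSplit (n ℕ.+ l) l fs) (length-map (term a) ids) ⟩
    pow (- 1#) (length ids) * altSplit (n ℕ.+ l) l fs
      ≈⟨ *-congˡ (altSplit-map (n ℕ.+ l) l (term a) ids) ⟩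
    pow (- 1#) (length ids) * sum0 (length ids) (λ j → pow (- 1#) j
      * (ζ (n ℕ.+ l) (take j ids) a * ζ⋆ l (reverse (drop j ids)) a)) ∎
    where
    fs = map (term a) ids
    σ = pow (- 1#) (length fs)
    σ*[σ*x]≈x : ∀ x → σ * (σ * x) ≈ x
    σ*[σ*x]≈x x = trans (sym (*-assoc σ σ x)) (trans (*-congʳ ([-1]^r*[-1]^r≈1 (length fs))) (*-identityˡ x))

theorem4p7 : ∀ {c ℓ : Level} (F : Field c ℓ) →
    let open FieldOps F
    in (a : Carrier) → (∀ (m : ℕ) → ¬ ((fromℕ (suc m) + a) ≈ 0#)) →
       (r : ℕ) (k : Fin r → ℕ) → (∀ j → 1 ≤ k j) →
       (x xa : Fin r → Carrier) →
       (n : ℕ) → 1 ≤ n → (l : ℕ) →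
       let ids = idxList r k x xa in
       S n (map (λ e m → term a e (m Data.Nat.+ l)) ids)
         ≈ pow (- 1#) r * sum0 r (λ j → pow (- 1#) j
              * (ζ (n Data.Nat.+ l) (take j ids) a * ζ⋆ l (reverse (drop j ids)) a))
theorem4p7 F a _ r k _ x xa n _ l =
  ≡.subst (λ R → S n (map (λ e m → term a e (m ℕ.+ l)) ids)
                   ≈ pow (- 1#) R * sum0 R (λ j → pow (- 1#) j
                       * (ζ (n ℕ.+ l) (take j ids) a * ζ⋆ l (reverse (drop j ids)) a)))
    (length-tabulate (λ j → (k j , x j , xa j)))
    (NestedSums.shifted-ζ F a n l ids)
  where
  open FieldOps F
  ids = idxList r k x xa
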